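{- For every $k \geqslant 0$ and every $i \in \{1, \ldots, n_k\}$, with the formulas $A^k_i, B^k_i$, numbers $n_k$ and $l_0$ defined in the context, we have $|A^k_i| < l_0 \cdot 5^k$ and $|B^k_i| < l_0 \cdot 5^k$.
   Context: Formulas are built from propositional variables and $\bot$ using $\wedge,\vee,\to,\Diamond,\Box$; $|\psi|$ denotes the number of symbols of $\psi$ (variables encoded in binary). Fix a propositional variable $p$ and define $G_1 = \Diamond p$, $G_2 = \Diamond p \to p$, $G_3 = p \to \Box p$; level 0 ($n_0 = 2$): $A_1^0 = G_2 \to G_1 \vee G_3$, $A_2^0 = G_3 \to G_1 \vee G_2$, $B_1^0 = G_1 \to G_2 \vee G_3$, $B_2^0 = A_1^0 \wedge A_2^0 \wedge B_1^0 \to G_1 \vee G_2 \vee G_3$; level 1 ($n_1 = 3$): $A_1^1 = A_1^0 \wedge A_2^0 \to B_1^0 \vee B_2^0$, $A_2^1 = A_1^0 \wedge B_1^0 \to A_2^0 \vee B_2^0$, $A_3^1 = A_1^0 \wedge B_2^0 \to A_2^0 \vee B_1^0$, $B_1^1 = A_2^0 \wedge B_1^0 \to A_1^0 \vee B_2^0$, $B_2^1 = A_2^0 \wedge B_2^0 \to A_1^0 \vee B_1^0$, $B_3^1 = B_1^0 \wedge B_2^0 \to A_1^0 \vee A_2^0$. Let $g$ be the bijection from $\{2,3,\dots\}\times\{2,3,\dots\}$ onto $\{1,2,3,\dots\}$ enumerating pairs in the following order: first $(2,2)$; then, for each $m = 3,4,5,\dots$ in turn, the pairs with $\max(i,j)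 = m$, listed for odd $m$ as $(m,2),(m,3),\dots,(m,m),(m-1,m),\dots,(2,m)$ and for even $m$ as $(2,m),(3,m),\dots,(m,m),(m,m-1),\dots,(m,2)$ (so $g(2,2)=1$, $g(3,2)=2$, $g(3,3)=3$, $g(2,3)=4$, $g(2,4)=5$, ...). For $k \geqslant 1$ and all $i,j \in \{2,\dots,n_k\}$ define $A^{k+1}_{g(i,j)} = A^k_1 \to B^k_1 \vee A^k_i \vee B^k_j$ and $B^{k+1}_{g(i,j)} = B^k_1 \to A^k_1 \vee A^k_i \vee B^k_j$, and $n_{k+1} = (n_k-1)^2$ (the indices $g(i,j)$ then range exactly over $\{1,\dots,n_{k+1}\}$). Finally $l_0 = |A_1^0| + |B_1^0| + |A_2^0| + |B_2^0|$. -}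

module Defs where

open import Data.Nat using (ℕ; zero; suc; _+_; _*_; _∸_; _^_; _⊔_; _≡ᵇ_; _<ᵇ_)
open import Data.Nat.Logarithm using (⌊log₂_⌋)
open import Data.Bool using (Bool; true; false; if_then_else_; _∧_)
open import Data.List using (List; []; _∷_; map; upTo; concatMap)
open import Data.Maybe using (Maybe; just; nothing)
open import Data.Product using (_×_; _,_)

data Fm : Set where
  var  : ℕ → Fm
  ⊥'   : Fm
  _∧'_ : Fm → Fm → Fm
  _∨'_ : Fm → Fm → Fm
  _⇒_  : Fm → Fm → Fm
  ◇_   : Fm → Fm
  □_   : Fm → Fm

infixr 6 _∧'_
infixr 5 _∨'_
infixr 4 _⇒_
infix 7 ◇_ □_

bitlen : ℕ → ℕ
bitlen n = suc ⌊log₂ n ⌋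

-- |ψ| : number of symbols (each connective is one symbol, a variable
-- contributes the number of digits of its binary index, ⊥ is one symbol)
size : Fm → ℕ
size (var n)  = bitlen n
size ⊥'       = 1
size (a ∧' b) = suc (size a + size b)
size (a ∨' b) = suc (size a + size b)
size (a ⇒ b)  = suc (size a + size b)
size (◇ a)    = suc (size a)
size (□ a)    = suc (size a)

-- The enumeration g of {2,3,...}×{2,3,...} onto {1,2,3,...}
isOdd : ℕ → Bool
isOdd zero = false
isOdd (suc n) = if isOdd n then false else true

-- position (1-based) of (i,j) inside the block of pairs with max(i,j) = m
blockPos : ℕ → ℕ → ℕ → ℕ
blockPos m i j =
  if isOdd m
  then (if i ≡ᵇ m then j ∸ 1 else (m ∸ 1) + (m ∸ i))
  else (if j ≡ᵇ m then i ∸ 1 else (m ∸ 1) + (m ∸ j))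

g : ℕ → ℕ → ℕ
g i j = let m = i ⊔ j in
  if m ≡ᵇ 2 then 1 else (m ∸ 2) ^ 2 + blockPos m i j

from2 : ℕ → List ℕ
from2 N = map (2 +_) (upTo (N ∸ 1))

findPair : ℕ → List (ℕ × ℕ) → Maybe (ℕ × ℕ)
findPair m [] = nothing
findPair m ((i , j) ∷ ps) = if g i j ≡ᵇ m then just (i , j) else findPair m ps

-- g⁻¹ m : the unique (i,j) with i,j ≥ 2 and g(i,j) = m (if m ≥ 1).
-- Since g(i,j) ≥ max(i,j) - 1, it suffices to search i,j ∈ {2,…,m+1}.
ginv : ℕ → Maybe (ℕ × ℕ)
ginv m = findPair m (concatMap (λ i → map (i ,_) (from2 (suc m))) (from2 (suc m)))

nn : ℕ → ℕ
nn zero = 2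
nn (suc zero) = 3
nn (suc (suc k)) = (nn (suc k) ∸ 1) ^ 2

module _ (p : ℕ) where
  G₁ G₂ G₃ : Fm
  G₁ = ◇ var p
  G₂ = ◇ var p ⇒ var p
  G₃ = var p ⇒ □ var p

  A0₁ A0₂ B0₁ B0₂ : Fm
  A0₁ = G₂ ⇒ G₁ ∨' G₃
  A0₂ = G₃ ⇒ G₁ ∨' G₂
  B0₁ = G₁ ⇒ G₂ ∨' G₃
  B0₂ = A0₁ ∧' A0₂ ∧' B0₁ ⇒ G₁ ∨' G₂ ∨' G₃

  stepA stepB : (ℕ → Fm) → (ℕ → Fm) → ℕ → Fm
  stepA a b m with ginv m
  ... | just (i , j) = a 1 ⇒ b 1 ∨' a i ∨' b j
  ... | nothing = ⊥'
  stepB a b m with ginv m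
  ... | just (i , j) = b 1 ⇒ a 1 ∨' a i ∨' b j
  ... | nothing = ⊥'

  -- A k i and B k i are A^k_i, B^k_i for 1 ≤ i ≤ n_k (value ⊥' outside that range)
  A B : ℕ → ℕ → Fm
  A zero 1 = A0₁
  A zero 2 = A0₂
  A zero _ = ⊥'
  A (suc zero) 1 = A0₁ ∧' A0₂ ⇒ B0₁ ∨' B0₂
  A (suc zero) 2 = A0₁ ∧' B0₁ ⇒ A0₂ ∨' B0₂
  A (suc zero) 3 = A0₁ ∧' B0₂ ⇒ A0₂ ∨' B0₁
  A (suc zero) _ = ⊥'
  A (suc (suc k)) m = stepA (A (suc k)) (B (suc k)) m
  B zero 1 = B0₁
  B zero 2 = B0₂
  B zero _ = ⊥'
  B (suc zero) 1 = A0₂ ∧' B0₁ ⇒ A0₁ ∨' B0₂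
  B (suc zero) 2 = A0₂ ∧' B0₂ ⇒ A0₁ ∨' B0₁
  B (suc zero) 3 = B0₁ ∧' B0₂ ⇒ A0₁ ∨' A0₂
  B (suc zero) _ = ⊥'
  B (suc (suc k)) m = stepB (A (suc k)) (B (suc k)) m

  l₀ : ℕ
  l₀ = size A0₁ + size B0₁ + size A0₂ + size B0₂

-- Each formula of level k+1 is built with three binary connectives from four
-- formulas of level k, so if every level-k formula has fewer than M symbols,
-- every level-(k+1) formula has at most 3 + 4(M − 1) < 4M symbols. At level 0
-- every A⁰ᵢ, B⁰ᵢ is one of the four positive summands of l₀, hence shorter
-- than l₀, and the bound l₀·5ᵏ follows by induction on k.
module Submission where

open import Defs
open import Data.Nat using (ℕ; zero; suc; _+_; _*_; _^_; _<_; _≤_; z≤n; s≤s)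
open import Data.Nat.Properties
open import Data.Nat.Tactic.RingSolver using (solve-∀)
open import Data.Maybe using (just; nothing)
open import Data.Product using (_×_; _,_; proj₁; proj₂)
open import Relation.Binary.PropositionalEquality using (_≡_; sym; subst)
open import Algebra.Properties.CommutativeSemigroup *-commutativeSemigroup
  using (x∙yz≈y∙xz)

size-pos : ∀ f → 0 < size f
size-pos (var _)   = s≤s z≤n
size-pos ⊥'        = s≤s z≤n
size-pos (_ ∧' _)  = s≤s z≤n
size-pos (_ ∨' _)  = s≤s z≤n
size-pos (_ ⇒ _)   = s≤s z≤n
size-pos (◇ _)     = s≤s z≤n
size-pos (□ _)     = s≤s z≤n

size-⊥'-< : ∀ {M} f → size f < M → size ⊥' < M
size-⊥'-< f = ≤-<-trans (size-pos f)

summands-< : ∀ {a b c d} → 0 < a → 0 < b →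
  a < a + b + c + d × b < a + b + c + d × c < a + b + c + d × d < a + b + c + d
summands-< {a} {b} {c} {d} 0<a 0<b =
    <-≤-trans (m<m+n a 0<b) a+b≤L
  , <-≤-trans (m<n+m b 0<a) a+b≤L
  , <-≤-trans (m<n+m c 0<a+b) (m≤m+n (a + b + c) d)
  , m<n+m d (<-≤-trans 0<a+b (m≤m+n (a + b) c))
  where
  0<a+b : 0 < a + b
  0<a+b = <-≤-trans 0<a (m≤m+n a b)
  a+b≤L : a + b ≤ a + b + c + d
  a+b≤L = ≤-trans (m≤m+n (a + b) c) (m≤m+n (a + b + c) d)

four-sucs : ∀ x y z w → 4 + (x + y + z + w) ≡ suc x + suc y + suc z + suc w
four-sucs = solve-∀

four-times : ∀ M → M + M + M + M ≡ 4 * M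
four-times = solve-∀

three+sum4-< : ∀ {M x y z w} → x < M → y < M → z < M → w < M →
  3 + (x + y + z + w) < 5 * M
three+sum4-< {M} {x} {y} {z} {w} x<M y<M z<M w<M = begin-strict
  3 + (x + y + z + w)            <⟨ n<1+n _ ⟩
  4 + (x + y + z + w)            ≡⟨ four-sucs x y z w ⟩
  suc x + suc y + suc z + suc w  ≤⟨ +-mono-≤ (+-mono-≤ (+-mono-≤ x<M y<M) z<M) w<M ⟩
  M + M + M + M                  ≡⟨ four-times M ⟩
  4 * M                          ≤⟨ *-monoˡ-≤ M (n≤1+n 4) ⟩
  5 * M                          ∎
  where open ≤-Reasoning

size-∧⇒∨ : ∀ a b c d → size (a ∧' b ⇒ c ∨' d) ≡ 3 + (size a + size b + size c + size d)
size-∧⇒∨ a b c d = shape (size a) (size b) (size c) (size d)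
  where
  shape : ∀ x y z w → suc (suc (x + y) + suc (z + w)) ≡ 3 + (x + y + z + w)
  shape = solve-∀

size-⇒∨∨ : ∀ a b c d → size (a ⇒ b ∨' c ∨' d) ≡ 3 + (size a + size b + size c + size d)
size-⇒∨∨ a b c d = shape (size a) (size b) (size c) (size d)
  where
  shape : ∀ x y z w → suc (x + suc (y + suc (z + w))) ≡ 3 + (x + y + z + w)
  shape = solve-∀

size-∧⇒∨-< : ∀ {M} a b c d → size a < M → size b < M → size c < M → size d < M →
  size (a ∧' b ⇒ c ∨' d) < 5 * M
size-∧⇒∨-< {M} a b c d ha hb hc hd =
  subst (_< 5 * M) (sym (size-∧⇒∨ a b c d)) (three+sum4-< ha hb hc hd)

size-⇒∨∨-< : ∀ {M} a b c d → size a < M → size b < M → size c < M → size d < M →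
  size (a ⇒ b ∨' c ∨' d) < 5 * M
size-⇒∨∨-< {M} a b c d ha hb hc hd =
  subst (_< 5 * M) (sym (size-⇒∨∨ a b c d)) (three+sum4-< ha hb hc hd)

module _ (p : ℕ) where

  -- Stated for every index m: outside 1 … n_k the formulas are ⊥', which is short.
  Bounded : ℕ → ℕ → Set
  Bounded k M = ∀ m → size (A p k m) < M × size (B p k m) < M

  private
    level-0-< : size (A0₁ p) < l₀ p × size (B0₁ p) < l₀ p × size (A0₂ p) < l₀ p × size (B0₂ p) < l₀ p
    level-0-< = summands-< (size-pos (A0₁ p)) (size-pos (B0₁ p))

    ⊥'<l₀ : size ⊥' < l₀ p
    ⊥'<l₀ = size-⊥'-< (A0₁ p) (proj₁ level-0-<)

  bounded-0 : Bounded 0 (l₀ p)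
  bounded-0 1 = proj₁ level-0-< , proj₁ (proj₂ level-0-<)
  bounded-0 2 = proj₁ (proj₂ (proj₂ level-0-<)) , proj₂ (proj₂ (proj₂ level-0-<))
  bounded-0 0 = ⊥'<l₀ , ⊥'<l₀
  bounded-0 (suc (suc (suc _))) = ⊥'<l₀ , ⊥'<l₀

  bounded-1 : ∀ {M} → Bounded 0 M → Bounded 1 (5 * M)
  bounded-1 {M} h = bound
    where
    a₁ : size (A0₁ p) < M
    a₁ = proj₁ (h 1)
    b₁ : size (B0₁ p) < M
    b₁ = proj₂ (h 1)
    a₂ : size (A0₂ p) < M
    a₂ = proj₁ (h 2)
    b₂ : size (B0₂ p) < M
    b₂ = proj₂ (h 2)
    ⊥'-< : size ⊥' < 5 * M
    ⊥'-< = size-⊥'-< (A0₁ p) (<-≤-trans a₁ (m≤n*m M 5))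
    bound : Bounded 1 (5 * M)
    bound 1 = size-∧⇒∨-< (A0₁ p) (A0₂ p) (B0₁ p) (B0₂ p) a₁ a₂ b₁ b₂
            , size-∧⇒∨-< (A0₂ p) (B0₁ p) (A0₁ p) (B0₂ p) a₂ b₁ a₁ b₂
    bound 2 = size-∧⇒∨-< (A0₁ p) (B0₁ p) (A0₂ p) (B0₂ p) a₁ b₁ a₂ b₂
            , size-∧⇒∨-< (A0₂ p) (B0₂ p) (A0₁ p) (B0₁ p) a₂ b₂ a₁ b₁
    bound 3 = size-∧⇒∨-< (A0₁ p) (B0₂ p) (A0₂ p) (B0₁ p) a₁ b₂ a₂ b₁
            , size-∧⇒∨-< (B0₁ p) (B0₂ p) (A0₁ p) (A0₂ p) b₁ b₂ a₁ a₂
    bound 0 = ⊥'-< , ⊥'-<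
    bound (suc (suc (suc (suc _)))) = ⊥'-< , ⊥'-<

  bounded-suc : ∀ {k M} → Bounded (suc k) M → Bounded (suc (suc k)) (5 * M)
  bounded-suc {k} {M} h m with ginv m
  ... | just (i , j) = size-⇒∨∨-< _ _ _ _ a₁ b₁ (proj₁ (h i)) (proj₂ (h j))
                     , size-⇒∨∨-< _ _ _ _ b₁ a₁ (proj₁ (h i)) (proj₂ (h j))
    where
    a₁ : size (A p (suc k) 1) < M
    a₁ = proj₁ (h 1)
    b₁ : size (B p (suc k) 1) < M
    b₁ = proj₂ (h 1)
  ... | nothing = ⊥'-< , ⊥'-<
    where
    ⊥'-< : size ⊥' < 5 * M
    ⊥'-< = size-⊥'-< (A p (suc k) 1) (<-≤-trans (proj₁ (h 1)) (m≤n*m M 5))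

  bounded-step : ∀ k {M} → Bounded k M → Bounded (suc k) (5 * M)
  bounded-step zero    = bounded-1
  bounded-step (suc k) = bounded-suc {k}

  bounded : ∀ k → Bounded k (l₀ p * 5 ^ k)
  bounded zero    = subst (Bounded 0) (sym (*-identityʳ (l₀ p))) bounded-0
  bounded (suc k) = subst (Bounded (suc k)) (x∙yz≈y∙xz 5 (l₀ p) (5 ^ k)) (bounded-step k (bounded k))

lemma3 : ∀ (p k i : ℕ) → 1 ≤ i → i ≤ nn k →
    size (A p k i) < l₀ p * 5 ^ k × size (B p k i) < l₀ p * 5 ^ k
lemma3 p k i _ _ = bounded p k i
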